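{- Let $(\mathcal H,\mathcal L)$ be a strictly balanced pair of finite families of graphs with $m_2(\mathcal H)>m_2(\mathcal L)>1$. Let $\alpha=m_2(\mathcal H,\mathcal L)$ and $X=\min_{H\in\mathcal H}\{(e_H-1)-\alpha(v_H-2)\}$. Then for every $L\in\mathcal L$ and every subgraph $K\subseteq L$ with at least one edge, \[X+(v_K-2)(\alpha-1)\ge e_K\Big(\frac{\alpha}{m_2(L)}-1\Big).\] Moreover, the inequality is strict unless $K=K_2$.
   Context: For a graph $J$, $v_J,e_J$ are its numbers of vertices and edges. For a graph $H$: $m_2(H)=\max\{(e_J-1)/(v_J-2): J\subseteq H, v_J\ge 3\}$ if $H$ has an edge and $v_H\ge3$; $m_2(K_2)=1/2$; $m_2(H)=0$ if $H$ has no edges. For a finite family $\mathcal H$, $m_2(\mathcal H)=\min_{H\in\mathcal H}m_2(H)$. For a graph $H$, $m_2(H,\mathcal L)=\max\{e_J/(v_J-2+1/m_2(\mathcal L)): J\subseteq H, v_J\ge 2\}$, and $m_2(\mathcal H,\mathcal L)=\min_{H\in\mathcal H}m_2(H,\mathcal L)$. $(\mathcal H,\mathcal L)$ is strictly balanced if every $L\in\mathcal L$ satisfies $m_2(L')<m_2(L)$ for all proper subgraphs $L'\subsetneq L$, and every $H\in\mathcal H$ satisfies $m_2(H',\mathcal L)<m_2(H,\mathcal L)$ for all proper subgraphs $H'\subsetneq H$. -}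

module Defs where

open import Data.Nat as ℕ using (ℕ; zero; suc)
open import Data.Integer as ℤ using (ℤ; +_)
open import Data.Rational as ℚ using (ℚ; 0ℚ; 1ℚ; ½; _≟_; _÷_; _+_; _-_; _*_; _⊔_; _⊓_; _≤_; _<_; ≢-nonZero)
open import Data.Fin using (Fin; toℕ)
open import Data.Fin.Subset using (Subset; Side; inside; outside; _∈_; ∣_∣)
open import Data.Fin.Subset.Properties using (_∈?_)
open import Data.List using (List; []; _∷_; [_]; _++_; map; filter; foldr; length; concatMap)
open import Data.List.Relation.Unary.All using (All)
open import Data.List.Relation.Unary.Unique.Propositional using (Unique)
open import Data.List.Membership.Propositional renaming (_∈_ to _∈ˡ_)
open import Data.Vec using (Vec; []; _∷_)
open import Data.Product using (_×_; _,_; Σ; proj₁; proj₂)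
open import Relation.Nullary using (¬_; yes; no)
open import Relation.Nullary.Decidable using (_×-dec_)
open import Relation.Binary.PropositionalEquality using (_≡_; _≢_)

-- Using an ambient Fin n makes the
-- class of graphs closed under taking subgraphs without relabelling.

record Graph : Set where
  constructor graph
  field
    n : ℕ
    V : Subset n
    E : List (Fin n × Fin n)
open Graph public

-- A graph is simple: every edge {i,j} is stored once as (i , j) with
-- i < j, both endpoints are vertices of the graph, no edge repeated.
Simple : Graph → Set
Simple G = All (λ ij → (proj₁ ij ∈ V G) × (proj₂ ij ∈ V G) × (toℕ (proj₁ ij) ℕ.< toℕ (proj₂ ij))) (E G)
         × Unique (E G)

v : Graph → ℕ
v G = ∣ V G ∣

e : Graph → ℕ
e G = length (E G)

subsetsOf : ∀ {n} → Subset n → List (Subset n)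
subsetsOf [] = [ [] ]
subsetsOf (outside ∷ p) = map (outside ∷_) (subsetsOf p)
subsetsOf (inside ∷ p) = map (outside ∷_) (subsetsOf p) ++ map (inside ∷_) (subsetsOf p)

sublists : ∀ {A : Set} → List A → List (List A)
sublists [] = [ [] ]
sublists (x ∷ xs) = map (x ∷_) (sublists xs) ++ sublists xs

subgraphs : Graph → List Graph
subgraphs (graph n V E) =
  concatMap (λ V' → map (graph n V')
                        (sublists (filter (λ ij → (proj₁ ij ∈? V') ×-dec (proj₂ ij ∈? V')) E)))
            (subsetsOf V)

_⊆G_ : Graph → Graph → Set
J ⊆G G = J ∈ˡ subgraphs G

_⊊G_ : Graph → Graph → Set
J ⊊G G = (J ⊆G G) × (J ≢ G)

ℕ→ℚ : ℕ → ℚ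
ℕ→ℚ k = + k ℚ./ 1

-- total division; it is only ever applied to nonzero denominators below
_÷'_ : ℚ → ℚ → ℚ
p ÷' q with q ≟ 0ℚ
... | yes _ = 0ℚ
... | no q≢0 = _÷_ p q {{≢-nonZero q≢0}}

-- maximum / minimum of a list (the lists used below are nonempty;
-- the empty case is an arbitrary junk value)
maxOf : List ℚ → ℚ
maxOf [] = 0ℚ
maxOf (x ∷ xs) = foldr _⊔_ x xs

minOf : List ℚ → ℚ
minOf [] = 0ℚ
minOf (x ∷ xs) = foldr _⊓_ x xs

d2 : Graph → ℚ
d2 J = (ℕ→ℚ (e J) - 1ℚ) ÷' (ℕ→ℚ (v J) - ℕ→ℚ 2)

m2 : Graph → ℚ
m2 H with e H | v H
... | zero | _ = 0ℚ
... | suc _ | 2 = ½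
... | suc _ | _ = maxOf (map d2 (filter (λ J → 3 ℕ.≤? v J) (subgraphs H)))

m2F : List Graph → ℚ
m2F 𝓗 = minOf (map m2 𝓗)

m2HL : Graph → List Graph → ℚ
m2HL H 𝓛 = maxOf (map (λ J → ℕ→ℚ (e J) ÷' ((ℕ→ℚ (v J) - ℕ→ℚ 2) + (1ℚ ÷' m2F 𝓛)))
                      (filter (λ J → 2 ℕ.≤? v J) (subgraphs H)))

m2FL : List Graph → List Graph → ℚ
m2FL 𝓗 𝓛 = minOf (map (λ H → m2HL H 𝓛) 𝓗)

StrictlyBalanced : List Graph → List Graph → Set
StrictlyBalanced 𝓗 𝓛 =
  (∀ L → L ∈ˡ 𝓛 → ∀ L' → L' ⊊G L → m2 L' < m2 L) ×
  (∀ H → H ∈ˡ 𝓗 → ∀ H' → H' ⊊G H → m2HL H' 𝓛 < m2HL H 𝓛)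

Xval : List Graph → ℚ → ℚ
Xval 𝓗 α = minOf (map (λ H → (ℕ→ℚ (e H) - 1ℚ) - α * (ℕ→ℚ (v H) - ℕ→ℚ 2)) 𝓗)

IsK2 : Graph → Set
IsK2 K = (v K ≡ 2) × (e K ≡ 1)

{-# OPTIONS --safe #-}

-- Write m = m₂(𝓛), ℓ = m₂(L) and w = v_K − 2.  Strict balancedness makes every H ∈ 𝓗 attain
-- its own maximum in m₂(H,𝓛), so α ≤ e_H/(v_H − 2 + 1/m), i.e. X ≥ α/m − 1 ≥ α/ℓ − 1; a densest
-- subgraph of each H ∈ 𝓗 shows m < α.  For K ⊆ L the definition of m₂(L) gives e_K − 1 ≤ ℓ w.
-- Since 1/ℓ · ℓ = 1, the right-hand side minus the left-hand side equals
--   (X − (α/ℓ − 1)) + (α − 1)(w − (e_K − 1)/ℓ) + (e_K − 1)(1 − 1/ℓ),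
-- a sum of nonnegative terms, and the last two vanish together only when e_K = 1 and v_K = 2.

module Submission where

open import Defs
open import Data.Empty using (⊥-elim)
open import Data.Fin using (Fin)
import Data.Fin.Properties as Fin
open import Data.Fin.Subset using (Subset; ∣_∣; inside; outside) renaming (_∈_ to _∈ₛ_)
open import Data.Fin.Subset.Properties using (_∈?_; x∈p∧x≢y⇒x∈p-y; x∈p⇒∣p-x∣<∣p∣)
open import Data.Integer as ℤ using (+_)
import Data.Integer.Properties as ℤₚ
open import Data.List using (List; []; _∷_; map; filter; foldr; length)
open import Data.List.Properties using (filter-all; foldr-preservesᵇ; foldr-preservesᵒ)
open import Data.List.Relation.Unary.All as All using (All; []; _∷_)
import Data.List.Relation.Unary.All.Properties as All
open import Data.List.Relation.Unary.AllPairs using ([]; _∷_)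
open import Data.List.Relation.Unary.Any as Any using (here; there)
open import Data.List.Relation.Unary.Unique.Propositional using (Unique)
import Data.List.Relation.Unary.Unique.Propositional.Properties as Unique
open import Data.List.Membership.Propositional using (_∈_; find; lose)
open import Data.List.Membership.Propositional.Properties
open import Data.Nat as ℕ using (_≥_; z≤n; s≤s)
import Data.Nat.Properties as ℕₚ
import Data.Nat.Coprimality as Coprime
open import Data.Product using (_×_; _,_; ∃-syntax; proj₁; proj₂)
open import Data.Rational using (ℚ; mkℚ; 0ℚ; 1ℚ; _+_; _-_; -_; _*_; _≤_; _<_; _⊔_; _⊓_; 1/_; *≤*; *<*; positive; nonNegative; ≢-nonZero)
import Data.Rational as ℚ
open import Data.Rational.Properties
open import Data.Rational.Solver using (module +-*-Solver)
open import Data.Sum using (_⊎_; inj₁; inj₂)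
open import Data.Vec using ([]; _∷_)
open import Function using (_∘_)
open import Relation.Binary.PropositionalEquality
open import Relation.Nullary using (¬_; yes; no)
open import Relation.Nullary.Decidable using (_×-dec_)

open +-*-Solver

-- ℕ→ℚ normalises by a gcd, which does not compute on a variable k.
ℕ→ℚ≡mkℚ : ∀ k → ℕ→ℚ k ≡ mkℚ (+ k) 0 (Coprime.sym (Coprime.1-coprimeTo k))
ℕ→ℚ≡mkℚ k = normalize-coprime (Coprime.sym (Coprime.1-coprimeTo k))

ℕ→ℚ-mono-≤ : ∀ {a b} → a ℕ.≤ b → ℕ→ℚ a ≤ ℕ→ℚ b
ℕ→ℚ-mono-≤ {a} {b} a≤b rewrite ℕ→ℚ≡mkℚ a | ℕ→ℚ≡mkℚ b =
  *≤* (subst₂ ℤ._≤_ (sym (ℤₚ.*-identityʳ (+ a))) (sym (ℤₚ.*-identityʳ (+ b))) (ℤ.+≤+ a≤b))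

ℕ→ℚ-mono-< : ∀ {a b} → a ℕ.< b → ℕ→ℚ a < ℕ→ℚ b
ℕ→ℚ-mono-< {a} {b} a<b rewrite ℕ→ℚ≡mkℚ a | ℕ→ℚ≡mkℚ b =
  *<* (subst₂ ℤ._<_ (sym (ℤₚ.*-identityʳ (+ a))) (sym (ℤₚ.*-identityʳ (+ b))) (ℤ.+<+ a<b))

0<1 : 0ℚ < 1ℚ
0<1 = *<* (ℤ.+<+ (s≤s z≤n))

p≤q⇒0≤q-p : ∀ {p q} → p ≤ q → 0ℚ ≤ q - p
p≤q⇒0≤q-p {p} {q} p≤q = subst (_≤ q - p) (+-inverseʳ p) (+-monoˡ-≤ (- p) p≤q)

p<q⇒0<q-p : ∀ {p q} → p < q → 0ℚ < q - p
p<q⇒0<q-p {p} {q} p<q = subst (_< q - p) (+-inverseʳ p) (+-monoˡ-< (- p) p<q)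

0≤q-p⇒p≤q : ∀ {p q} → 0ℚ ≤ q - p → p ≤ q
0≤q-p⇒p≤q {p} {q} 0≤q-p =
  subst₂ _≤_ (+-identityˡ p) (solve 2 (λ p q → (q :- p) :+ p := q) refl p q) (+-monoˡ-≤ p 0≤q-p)

p≤p+q : ∀ {p q} → 0ℚ ≤ q → p ≤ p + q
p≤p+q {p} {q} 0≤q = subst (_≤ p + q) (+-identityʳ p) (+-monoʳ-≤ p 0≤q)

p<p+q : ∀ {p q} → 0ℚ < q → p < p + q
p<p+q {p} {q} 0<q = subst (_< p + q) (+-identityʳ p) (+-monoʳ-< p 0<q)

*-nonNeg : ∀ {p q} → 0ℚ ≤ p → 0ℚ ≤ q → 0ℚ ≤ p * q
*-nonNeg {p} {q} 0≤p 0≤q = subst (_≤ p * q) (*-zeroʳ p) (*-monoˡ-≤-nonNeg p {{nonNegative 0≤p}} 0≤q)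

*-pos : ∀ {p q} → 0ℚ < p → 0ℚ < q → 0ℚ < p * q
*-pos {p} {q} 0<p 0<q = subst (_< p * q) (*-zeroʳ p) (*-monoʳ-<-pos p {{positive 0<p}} 0<q)

module _ {d : ℚ} (0<d : 0ℚ < d) where
  private instance
    d-pos : ℚ.Positive d
    d-pos = positive 0<d

  ÷'-*-cancel : ∀ p → (p ÷' d) * d ≡ p
  ÷'-*-cancel p with d ℚ.≟ 0ℚ
  ... | yes d≡0 = ⊥-elim (<-irrefl (sym d≡0) 0<d)
  ... | no d≢0 = begin
      p * 1/ d * d    ≡⟨ *-assoc p (1/ d) d ⟩
      p * (1/ d * d)  ≡⟨ cong (p *_) (*-inverseˡ d) ⟩
      p * 1ℚ          ≡⟨ *-identityʳ p ⟩
      p               ∎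
    where open ≡-Reasoning
          instance _ = ≢-nonZero d≢0

  ÷'≡*1÷' : ∀ p → p ÷' d ≡ p * (1ℚ ÷' d)
  ÷'≡*1÷' p with d ℚ.≟ 0ℚ
  ... | yes d≡0 = ⊥-elim (<-irrefl (sym d≡0) 0<d)
  ... | no d≢0 = cong (p *_) (sym (*-identityˡ _))
    where instance _ = ≢-nonZero d≢0

  ≤÷'⇒*≤ : ∀ {a p} → a ≤ p ÷' d → a * d ≤ p
  ≤÷'⇒*≤ {a} {p} h = subst (a * d ≤_) (÷'-*-cancel p) (*-monoʳ-≤-nonNeg d {{pos⇒nonNeg d}} h)

  <÷'⇒*< : ∀ {a p} → a < p ÷' d → a * d < p
  <÷'⇒*< {a} {p} h = subst (a * d <_) (÷'-*-cancel p) (*-monoˡ-<-pos d h)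

  ÷'≤⇒≤* : ∀ {a p} → p ÷' d ≤ a → p ≤ a * d
  ÷'≤⇒≤* {a} {p} h = subst (_≤ a * d) (÷'-*-cancel p) (*-monoʳ-≤-nonNeg d {{pos⇒nonNeg d}} h)

  *≤⇒≤÷' : ∀ {a p} → a * d ≤ p → a ≤ p ÷' d
  *≤⇒≤÷' {a} {p} h = *-cancelʳ-≤-pos d (subst (a * d ≤_) (sym (÷'-*-cancel p)) h)

  *<⇒<÷' : ∀ {a p} → a * d < p → a < p ÷' d
  *<⇒<÷' {a} {p} h = *-cancelʳ-<-nonNeg d {{pos⇒nonNeg d}} (subst (a * d <_) (sym (÷'-*-cancel p)) h)

  1÷'-pos : 0ℚ < 1ℚ ÷' d
  1÷'-pos = *<⇒<÷' (subst (_< 1ℚ) (sym (*-zeroˡ d)) 0<1)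

1÷'-antimono-≤ : ∀ {m ℓ} → 0ℚ < m → m ≤ ℓ → 1ℚ ÷' ℓ ≤ 1ℚ ÷' m
1÷'-antimono-≤ {m} {ℓ} 0<m m≤ℓ = *≤⇒≤÷' 0<m (begin
  (1ℚ ÷' ℓ) * m  ≤⟨ *-monoˡ-≤-nonNeg (1ℚ ÷' ℓ) {{nonNegative (<⇒≤ (1÷'-pos 0<ℓ))}} m≤ℓ ⟩
  (1ℚ ÷' ℓ) * ℓ  ≡⟨ ÷'-*-cancel 0<ℓ 1ℚ ⟩
  1ℚ             ∎)
  where open ≤-Reasoning
        0<ℓ = <-≤-trans 0<m m≤ℓ

1÷'<1 : ∀ {ℓ} → 1ℚ < ℓ → 1ℚ ÷' ℓ < 1ℚ
1÷'<1 {ℓ} 1<ℓ = begin-strict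
  1ℚ ÷' ℓ         ≡⟨ sym (*-identityʳ _) ⟩
  (1ℚ ÷' ℓ) * 1ℚ  <⟨ *-monoʳ-<-pos (1ℚ ÷' ℓ) {{positive (1÷'-pos 0<ℓ)}} 1<ℓ ⟩
  (1ℚ ÷' ℓ) * ℓ   ≡⟨ ÷'-*-cancel 0<ℓ 1ℚ ⟩
  1ℚ              ∎
  where open ≤-Reasoning
        0<ℓ = <-trans 0<1 1<ℓ

<÷'-shift : ∀ {m ε w} → 0ℚ < m → 0ℚ < w → m < (ε - 1ℚ) ÷' w → m < ε ÷' (w + 1ℚ ÷' m)
<÷'-shift {m} {ε} {w} 0<m 0<w m<[ε-1]/w =
  *<⇒<÷' (+-mono-<-≤ 0<w (<⇒≤ (1÷'-pos 0<m))) (begin-strict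
    m * (w + 1ℚ ÷' m)        ≡⟨ *-distribˡ-+ m w (1ℚ ÷' m) ⟩
    m * w + m * (1ℚ ÷' m)    ≡⟨ cong (_+_ (m * w)) (trans (*-comm m _) (÷'-*-cancel 0<m 1ℚ)) ⟩
    m * w + 1ℚ               <⟨ +-monoˡ-< 1ℚ (<÷'⇒*< 0<w m<[ε-1]/w) ⟩
    (ε - 1ℚ) + 1ℚ            ≡⟨ solve 1 (λ ε → (ε :- con 1ℚ) :+ con 1ℚ := ε) refl ε ⟩
    ε                        ∎)
  where open ≤-Reasoning

≤÷'-rearrange : ∀ {α ε w i} → 0ℚ < w + i → α ≤ ε ÷' (w + i) → α * i - 1ℚ ≤ (ε - 1ℚ) - α * w
≤÷'-rearrange {α} {ε} {w} {i} 0<w+i α≤ε/[w+i] =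
  0≤q-p⇒p≤q (subst (0ℚ ≤_) rearrange (p≤q⇒0≤q-p (≤÷'⇒*≤ 0<w+i α≤ε/[w+i])))
  where
    rearrange : ε - α * (w + i) ≡ ((ε - 1ℚ) - α * w) - (α * i - 1ℚ)
    rearrange = solve 4 (λ ε α w i → ε :- α :* (w :+ i) := ((ε :- con 1ℚ) :- α :* w) :- (α :* i :- con 1ℚ))
                  refl ε α w i

maxOf-≥ : ∀ {xs y} → y ∈ xs → y ≤ maxOf xs
maxOf-≥ {x ∷ xs} {y} y∈ = foldr-preservesᵒ join x xs (lift y∈)
  where
    join : ∀ a b → y ≤ a ⊎ y ≤ b → y ≤ a ⊔ b
    join a b (inj₁ y≤a) = ≤-trans y≤a (p≤p⊔q a b)
    join a b (inj₂ y≤b) = ≤-trans y≤b (p≤q⊔p a b)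
    lift : y ∈ x ∷ xs → y ≤ x ⊎ Any.Any (y ≤_) xs
    lift (here y≡x) = inj₁ (≤-reflexive y≡x)
    lift (there y∈xs) = inj₂ (Any.map ≤-reflexive y∈xs)

minOf-≤ : ∀ {xs y} → y ∈ xs → minOf xs ≤ y
minOf-≤ {x ∷ xs} {y} y∈ = foldr-preservesᵒ meet x xs (lift y∈)
  where
    meet : ∀ a b → a ≤ y ⊎ b ≤ y → a ⊓ b ≤ y
    meet a b (inj₁ a≤y) = ≤-trans (p⊓q≤p a b) a≤y
    meet a b (inj₂ b≤y) = ≤-trans (p⊓q≤q a b) b≤y
    lift : y ∈ x ∷ xs → x ≤ y ⊎ Any.Any (_≤ y) xs
    lift (here y≡x) = inj₁ (≤-reflexive (sym y≡x))
    lift (there y∈xs) = inj₂ (Any.map (≤-reflexive ∘ sym) y∈xs)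

module _ {P : ℚ → Set} where

  foldr-⊔-All : ∀ {x xs} → P x → All P xs → P (foldr _⊔_ x xs)
  foldr-⊔-All = foldr-preservesᵇ (λ {a} {b} → pick (⊔-sel a b))
    where
      pick : ∀ {a b} → a ⊔ b ≡ a ⊎ a ⊔ b ≡ b → P a → P b → P (a ⊔ b)
      pick (inj₁ eq) pa _ = subst P (sym eq) pa
      pick (inj₂ eq) _ pb = subst P (sym eq) pb

  foldr-⊓-All : ∀ {x xs} → P x → All P xs → P (foldr _⊓_ x xs)
  foldr-⊓-All = foldr-preservesᵇ (λ {a} {b} → pick (⊓-sel a b))
    where
      pick : ∀ {a b} → a ⊓ b ≡ a ⊎ a ⊓ b ≡ b → P a → P b → P (a ⊓ b)
      pick (inj₁ eq) pa _ = subst P (sym eq) pa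
      pick (inj₂ eq) _ pb = subst P (sym eq) pb

∈⇒≢[] : ∀ {A : Set} {x : A} {xs} → x ∈ xs → xs ≢ []
∈⇒≢[] {xs = []} () _
∈⇒≢[] {xs = _ ∷ _} _ ()

maxOf-∈ : ∀ {xs} → xs ≢ [] → maxOf xs ∈ xs
maxOf-∈ {[]} xs≢[] = ⊥-elim (xs≢[] refl)
maxOf-∈ {x ∷ xs} _ = foldr-⊔-All (here refl) (All.tabulate there)

minOf-map-All : ∀ {A : Set} {P : ℚ → Set} (f : A → ℚ) {xs} → xs ≢ [] →
                (∀ x → x ∈ xs → P (f x)) → P (minOf (map f xs))
minOf-map-All f {[]} xs≢[] _ = ⊥-elim (xs≢[] refl)
minOf-map-All {P = P} f {x ∷ xs} _ Pf =
  foldr-⊓-All {P} (Pf x (here refl)) (All.map⁺ (All.tabulate (Pf _ ∘ there)))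

sublists-All : ∀ {A : Set} {P : A → Set} xs {ys : List A} → ys ∈ sublists xs → All P xs → All P ys
sublists-All [] (here refl) [] = []
sublists-All (x ∷ xs) ys∈ (px ∷ pxs) with ∈-++⁻ (map (x ∷_) (sublists xs)) ys∈
... | inj₂ ys∈′ = sublists-All xs ys∈′ pxs
... | inj₁ ys∈′ with ∈-map⁻ (x ∷_) ys∈′
...   | zs , zs∈ , refl = px ∷ sublists-All xs zs∈ pxs

sublists-Unique : ∀ {A : Set} (xs : List A) {ys} → ys ∈ sublists xs → Unique xs → Unique ys
sublists-Unique [] (here refl) [] = []
sublists-Unique (x ∷ xs) ys∈ (x∉xs ∷ u) with ∈-++⁻ (map (x ∷_) (sublists xs)) ys∈
... | inj₂ ys∈′ = sublists-Unique xs ys∈′ u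
... | inj₁ ys∈′ with ∈-map⁻ (x ∷_) ys∈′
...   | zs , zs∈ , refl = sublists-All xs zs∈ x∉xs ∷ sublists-Unique xs zs∈ u

sublists-refl : ∀ {A : Set} (xs : List A) → xs ∈ sublists xs
sublists-refl [] = here refl
sublists-refl (x ∷ xs) = ∈-++⁺ˡ (∈-map⁺ (x ∷_) (sublists-refl xs))

subsetsOf-refl : ∀ {k} (p : Subset k) → p ∈ subsetsOf p
subsetsOf-refl [] = here refl
subsetsOf-refl (outside ∷ p) = ∈-map⁺ (outside ∷_) (subsetsOf-refl p)
subsetsOf-refl (inside ∷ p) =
  ∈-++⁺ʳ (map (outside ∷_) (subsetsOf p)) (∈-map⁺ (inside ∷_) (subsetsOf-refl p))

edgesWithin : ∀ {k} → Subset k → List (Fin k × Fin k) → List (Fin k × Fin k)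
edgesWithin W = filter (λ ij → (proj₁ ij ∈? W) ×-dec (proj₂ ij ∈? W))

⊆G⁻ : ∀ {J k W F} → J ⊆G graph k W F →
      ∃[ W′ ] ∃[ F′ ] (J ≡ graph k W′ F′) × (F′ ∈ sublists (edgesWithin W′ F))
⊆G⁻ {W = W} J∈ with find (∈-concatMap⁻ _ {xs = subsetsOf W} J∈)
... | W′ , _ , J∈′ with ∈-map⁻ (graph _ W′) J∈′
...   | F′ , F′∈ , J≡ = W′ , F′ , J≡ , F′∈

⊆G-Simple : ∀ {J G} → J ⊆G G → Simple G → Simple J
⊆G-Simple {J} {graph k W F} J⊆G (ok , unique) with ⊆G⁻ {J} {k} {W} {F} J⊆G
... | W′ , F′ , refl , F′∈ =
  sublists-All (edgesWithin W′ F) F′∈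
    (All.zipWith (λ ((i∈ , j∈) , (_ , _ , i<j)) → i∈ , j∈ , i<j)
      (All.all-filter _ F , All.filter⁺ _ ok))
  , sublists-Unique (edgesWithin W′ F) F′∈ (Unique.filter⁺ _ unique)

⊆G-refl : ∀ {G} → Simple G → G ⊆G G
⊆G-refl {graph k W F} (ok , _) =
  ∈-concatMap⁺ _ (lose (subsetsOf-refl W) (∈-map⁺ (graph k W) F∈))
  where
    F∈ : F ∈ sublists (edgesWithin W F)
    F∈ = subst (λ F′ → F ∈ sublists F′)
           (sym (filter-all _ (All.map (λ (i∈ , j∈ , _) → i∈ , j∈) ok)))
           (sublists-refl F)

length≤∣p∣ : ∀ {k} {p : Subset k} {xs : List (Fin k)} → Unique xs → All (_∈ₛ p) xs → length xs ℕ.≤ ∣ p ∣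
length≤∣p∣ {xs = []} _ _ = z≤n
length≤∣p∣ {p = p} {x ∷ xs} (x∉xs ∷ u) (x∈p ∷ xs⊆p) =
  ℕₚ.≤-trans (s≤s (length≤∣p∣ u (All.zipWith (λ (y∈p , x≢y) → x∈p∧x≢y⇒x∈p-y y∈p (x≢y ∘ sym)) (xs⊆p , x∉xs))))
             (x∈p⇒∣p-x∣<∣p∣ x∈p)

2≤∣p∣ : ∀ {k} {p : Subset k} {a b} → a ∈ₛ p → b ∈ₛ p → a ≢ b → 2 ℕ.≤ ∣ p ∣
2≤∣p∣ a∈ b∈ a≢b = length≤∣p∣ ((a≢b ∷ []) ∷ [] ∷ []) (a∈ ∷ b∈ ∷ [])

3≤∣p∣ : ∀ {k} {p : Subset k} {a b c} → a ∈ₛ p → b ∈ₛ p → c ∈ₛ p → a ≢ b → a ≢ c → b ≢ c → 3 ℕ.≤ ∣ p ∣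
3≤∣p∣ a∈ b∈ c∈ a≢b a≢c b≢c = length≤∣p∣ ((a≢b ∷ a≢c ∷ []) ∷ (b≢c ∷ []) ∷ [] ∷ []) (a∈ ∷ b∈ ∷ c∈ ∷ [])

Simple⇒2≤v : ∀ {G} → Simple G → 1 ℕ.≤ e G → 2 ℕ.≤ v G
Simple⇒2≤v {graph _ _ (_ ∷ _)} ((i∈ , j∈ , i<j) ∷ _ , _) (s≤s z≤n) = 2≤∣p∣ i∈ j∈ (Fin.<⇒≢ i<j)

Simple⇒3≤v : ∀ {G} → Simple G → 2 ℕ.≤ e G → 3 ℕ.≤ v G
Simple⇒3≤v {graph _ _ ((i , j) ∷ (i′ , j′) ∷ _)}
           ((i∈ , j∈ , i<j) ∷ (i′∈ , j′∈ , i′<j′) ∷ _ , (e≢e′ ∷ _) ∷ _) (s≤s (s≤s z≤n)) with i Fin.≟ i′ | j Fin.≟ i′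
... | yes refl | _ = 3≤∣p∣ i∈ j∈ j′∈ (Fin.<⇒≢ i<j) (Fin.<⇒≢ i′<j′) (λ j≡j′ → e≢e′ (cong (i ,_) j≡j′))
... | no i≢i′ | no j≢i′ = 3≤∣p∣ i∈ j∈ i′∈ (Fin.<⇒≢ i<j) i≢i′ j≢i′
... | no _ | yes refl = 3≤∣p∣ i∈ j∈ j′∈ (Fin.<⇒≢ i<j) (Fin.<⇒≢ (ℕₚ.<-trans i<j i′<j′)) (Fin.<⇒≢ i′<j′)

1<m2⇒1≤e : ∀ {H} → 1ℚ < m2 H → 1 ℕ.≤ e H
1<m2⇒1≤e {H} 1<m2 with e H
... | ℕ.zero = ⊥-elim (<-asym 1<m2 0<1)
... | ℕ.suc _ = s≤s z≤n

m2-candidates : Graph → List ℚ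
m2-candidates H = map d2 (filter (λ J → 3 ℕ.≤? v J) (subgraphs H))

1<m2⇒m2≡maxOf : ∀ {H} → 1ℚ < m2 H → m2 H ≡ maxOf (m2-candidates H)
1<m2⇒m2≡maxOf {H} 1<m2 with e H | v H
... | ℕ.zero | _ = ⊥-elim (<-asym 1<m2 0<1)
... | ℕ.suc _ | 2 = ⊥-elim (<-asym 1<m2 (*<* (ℤ.+<+ (s≤s (s≤s z≤n)))))
... | ℕ.suc _ | 0 = refl
... | ℕ.suc _ | 1 = refl
... | ℕ.suc _ | ℕ.suc (ℕ.suc (ℕ.suc _)) = refl

d2≤m2 : ∀ {H J} → 1ℚ < m2 H → J ⊆G H → 3 ℕ.≤ v J → d2 J ≤ m2 H
d2≤m2 {H} {J} 1<m2 J⊆H 3≤vJ =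
  subst (d2 J ≤_) (sym (1<m2⇒m2≡maxOf {H} 1<m2)) (maxOf-≥ (∈-map⁺ d2 (∈-filter⁺ (λ J → 3 ℕ.≤? v J) J⊆H 3≤vJ)))

m2-attained : ∀ {H} → 1ℚ < m2 H → ∃[ J ] (J ⊆G H) × (3 ℕ.≤ v J) × (d2 J ≡ m2 H)
m2-attained {H} 1<m2 = attained (∈-map⁻ d2 (maxOf-∈ nonempty))
  where
    m2≡maxOf = 1<m2⇒m2≡maxOf {H} 1<m2
    nonempty : m2-candidates H ≢ []
    nonempty ≡[] = <-asym (subst (1ℚ <_) m2≡maxOf 1<m2) (subst (λ xs → maxOf xs < 1ℚ) (sym ≡[]) 0<1)
    attained : ∃[ J ] J ∈ filter (λ J → 3 ℕ.≤? v J) (subgraphs H) × maxOf (m2-candidates H) ≡ d2 J →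
               ∃[ J ] (J ⊆G H) × (3 ℕ.≤ v J) × (d2 J ≡ m2 H)
    attained (J , J∈ , maxOf≡d2J) =
      let J⊆H , 3≤vJ = ∈-filter⁻ (λ J → 3 ℕ.≤? v J) {xs = subgraphs H} J∈
      in J , J⊆H , 3≤vJ , sym (trans m2≡maxOf maxOf≡d2J)

density : List Graph → Graph → ℚ
density 𝓛 J = ℕ→ℚ (e J) ÷' ((ℕ→ℚ (v J) - ℕ→ℚ 2) + (1ℚ ÷' m2F 𝓛))

density-denominator-pos : ∀ {𝓛 J} → 0ℚ < m2F 𝓛 → 2 ℕ.≤ v J → 0ℚ < (ℕ→ℚ (v J) - ℕ→ℚ 2) + (1ℚ ÷' m2F 𝓛)
density-denominator-pos 0<m 2≤v = +-mono-≤-< (p≤q⇒0≤q-p (ℕ→ℚ-mono-≤ 2≤v)) (1÷'-pos 0<m)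

density≤m2HL : ∀ {𝓛 H J} → J ⊆G H → 2 ℕ.≤ v J → density 𝓛 J ≤ m2HL H 𝓛
density≤m2HL {𝓛} J⊆H 2≤v = maxOf-≥ (∈-map⁺ (density 𝓛) (∈-filter⁺ (λ J → 2 ℕ.≤? v J) J⊆H 2≤v))

m2HL≤density : ∀ {𝓛 H} → (∀ H′ → H′ ⊊G H → m2HL H′ 𝓛 < m2HL H 𝓛) → Simple H → 2 ℕ.≤ v H →
               m2HL H 𝓛 ≤ density 𝓛 H
m2HL≤density {𝓛} {H} balanced simple 2≤v = ≮⇒≥ (maximiser⇒⊥ (∈-map⁻ (density 𝓛) (maxOf-∈ (∈⇒≢[] H∈))))
  where
    H∈ : density 𝓛 H ∈ map (density 𝓛) (filter (λ J → 2 ℕ.≤? v J) (subgraphs H))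
    H∈ = ∈-map⁺ (density 𝓛) (∈-filter⁺ (λ J → 2 ℕ.≤? v J) (⊆G-refl simple) 2≤v)
    maximiser⇒⊥ : ∃[ J ] J ∈ filter (λ J → 2 ℕ.≤? v J) (subgraphs H) × m2HL H 𝓛 ≡ density 𝓛 J →
                  ¬ (density 𝓛 H < m2HL H 𝓛)
    maximiser⇒⊥ (J , J∈ , m2HL≡) density<m2HL = <-irrefl refl (begin-strict
        m2HL H 𝓛    ≡⟨ m2HL≡ ⟩
        density 𝓛 J ≤⟨ density≤m2HL {𝓛} {J} {J} (⊆G-refl (⊆G-Simple {J} {H} J⊆H simple)) 2≤vJ ⟩
        m2HL J 𝓛    <⟨ balanced J (J⊆H , J≢H) ⟩
        m2HL H 𝓛    ∎)
      where
        open ≤-Reasoning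
        J⊆H = proj₁ (∈-filter⁻ (λ J → 2 ℕ.≤? v J) {xs = subgraphs H} J∈)
        2≤vJ = proj₂ (∈-filter⁻ (λ J → 2 ℕ.≤? v J) {xs = subgraphs H} J∈)
        J≢H : J ≢ H
        J≢H J≡H = <-irrefl (sym (trans m2HL≡ (cong (density 𝓛) J≡H))) density<m2HL

m2F<m2HL : ∀ {𝓛 H} → 1ℚ < m2F 𝓛 → m2F 𝓛 < m2 H → m2F 𝓛 < m2HL H 𝓛
m2F<m2HL {𝓛} {H} 1<m m<m2H = via (m2-attained {H} (<-trans 1<m m<m2H))
  where
    via : ∃[ J ] (J ⊆G H) × (3 ℕ.≤ v J) × (d2 J ≡ m2 H) → m2F 𝓛 < m2HL H 𝓛
    via (J , J⊆H , 3≤vJ , d2J≡m2H) = <-≤-trans m<density (density≤m2HL {𝓛} {H} {J} J⊆H (ℕₚ.<⇒≤ 3≤vJ))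
      where
        m<density : m2F 𝓛 < density 𝓛 J
        m<density = <÷'-shift (<-trans 0<1 1<m) (p<q⇒0<q-p (ℕ→ℚ-mono-< 3≤vJ))
                              (subst (m2F 𝓛 <_) (sym d2J≡m2H) m<m2H)

1≤n≱2⇒n≡1 : ∀ {n} → 1 ℕ.≤ n → ¬ (2 ℕ.≤ n) → n ≡ 1
1≤n≱2⇒n≡1 1≤n 2≰n = ℕₚ.≤-antisym (ℕₚ.≤-pred (ℕₚ.≰⇒> 2≰n)) 1≤n

subgraph-edge-bound : ∀ {L K} → Simple K → 1ℚ < m2 L → K ⊆G L → 1 ℕ.≤ e K →
                      ℕ→ℚ (e K) - 1ℚ ≤ m2 L * (ℕ→ℚ (v K) - ℕ→ℚ 2)
subgraph-edge-bound {L} {K} simple 1<m2 K⊆L 1≤e with 3 ℕ.≤? v K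
... | yes 3≤v = ÷'≤⇒≤* (p<q⇒0<q-p (ℕ→ℚ-mono-< 3≤v)) (d2≤m2 {L} 1<m2 K⊆L 3≤v)
... | no 3≰v = subst₂ (λ a b → ℕ→ℚ a - 1ℚ ≤ m2 L * (ℕ→ℚ b - ℕ→ℚ 2)) (sym e≡1) (sym v≡2)
                      (≤-reflexive (sym (*-zeroʳ (m2 L))))
  where
    e≡1 : e K ≡ 1
    e≡1 = 1≤n≱2⇒n≡1 1≤e (3≰v ∘ Simple⇒3≤v simple)
    v≡2 : v K ≡ 2
    v≡2 = ℕₚ.≤-antisym (ℕₚ.≤-pred (ℕₚ.≰⇒> 3≰v)) (Simple⇒2≤v simple 1≤e)

non-K2-slack : ∀ {K ℓ} → Simple K → 1 ℕ.≤ e K → ¬ IsK2 K → 0ℚ < ℓ →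
               1ℚ < ℕ→ℚ (e K) ⊎ ℕ→ℚ (e K) - 1ℚ < ℓ * (ℕ→ℚ (v K) - ℕ→ℚ 2)
non-K2-slack {K} {ℓ} simple 1≤e ¬K2 0<ℓ with 2 ℕ.≤? e K
... | yes 2≤e = inj₁ (ℕ→ℚ-mono-< 2≤e)
... | no 2≰e = inj₂ (subst (λ a → ℕ→ℚ a - 1ℚ < ℓ * (ℕ→ℚ (v K) - ℕ→ℚ 2)) (sym e≡1)
                           (*-pos 0<ℓ (p<q⇒0<q-p (ℕ→ℚ-mono-< 3≤v))))
  where
    e≡1 : e K ≡ 1
    e≡1 = 1≤n≱2⇒n≡1 1≤e 2≰e
    3≤v : 3 ℕ.≤ v K
    3≤v = ℕₚ.≤∧≢⇒< (Simple⇒2≤v simple 1≤e) (λ 2≡v → ¬K2 (sym 2≡v , e≡1))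

module BalancedFamily {𝓗 𝓛 : List Graph} (𝓗≢[] : 𝓗 ≢ []) (simple𝓗 : ∀ H → H ∈ 𝓗 → Simple H)
         (balanced𝓗 : ∀ H → H ∈ 𝓗 → ∀ H′ → H′ ⊊G H → m2HL H′ 𝓛 < m2HL H 𝓛)
         (m<m2F𝓗 : m2F 𝓛 < m2F 𝓗) (1<m : 1ℚ < m2F 𝓛) where

  private
    m = m2F 𝓛
    α = m2FL 𝓗 𝓛

    m<m2H : ∀ H → H ∈ 𝓗 → m < m2 H
    m<m2H H H∈ = <-≤-trans m<m2F𝓗 (minOf-≤ (∈-map⁺ m2 H∈))

    2≤v : ∀ H → H ∈ 𝓗 → 2 ℕ.≤ v H
    2≤v H H∈ = Simple⇒2≤v {H} (simple𝓗 H H∈) (1<m2⇒1≤e {H} (<-trans 1<m (m<m2H H H∈)))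

    α≤density : ∀ H → H ∈ 𝓗 → α ≤ density 𝓛 H
    α≤density H H∈ = ≤-trans (minOf-≤ (∈-map⁺ (λ H → m2HL H 𝓛) H∈))
                             (m2HL≤density {𝓛} {H} (balanced𝓗 H H∈) (simple𝓗 H H∈) (2≤v H H∈))

  m2F<m2FL : m < α
  m2F<m2FL = minOf-map-All {P = m <_} _ 𝓗≢[] (λ H H∈ → m2F<m2HL {𝓛} {H} 1<m (m<m2H H H∈))

  Xval-lower-bound : α * (1ℚ ÷' m) - 1ℚ ≤ Xval 𝓗 α
  Xval-lower-bound = minOf-map-All {P = α * (1ℚ ÷' m) - 1ℚ ≤_} _ 𝓗≢[] λ H H∈ →
    ≤÷'-rearrange {α} {ℕ→ℚ (e H)} {ℕ→ℚ (v H) - ℕ→ℚ 2}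
      (density-denominator-pos {𝓛} {H} (<-trans 0<1 1<m) (2≤v H H∈)) (α≤density H H∈)

slack-identity : ∀ X α ℓ i ε w → i * ℓ ≡ 1ℚ →
                 X + w * (α - 1ℚ)
                 ≡ ε * (α * i - 1ℚ)
                   + ((X - (α * i - 1ℚ)) + ((α - 1ℚ) * (i * (ℓ * w - (ε - 1ℚ))) + (ε - 1ℚ) * (1ℚ - i)))
slack-identity X α ℓ i ε w iℓ≡1 = begin
  X + w * (α - 1ℚ)
    ≡⟨ cong (λ t → X + t * (α - 1ℚ)) (sym (trans (cong (_* w) iℓ≡1) (*-identityˡ w))) ⟩
  X + ((i * ℓ) * w) * (α - 1ℚ)
    ≡⟨ solve 6 (λ X α ℓ i ε w →
         X :+ ((i :* ℓ) :* w) :* (α :- con 1ℚ)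
         := ε :* (α :* i :- con 1ℚ)
            :+ ((X :- (α :* i :- con 1ℚ))
                :+ ((α :- con 1ℚ) :* (i :* (ℓ :* w :- (ε :- con 1ℚ))) :+ (ε :- con 1ℚ) :* (con 1ℚ :- i))))
         refl X α ℓ i ε w ⟩
  ε * (α * i - 1ℚ) + ((X - (α * i - 1ℚ)) + ((α - 1ℚ) * (i * (ℓ * w - (ε - 1ℚ))) + (ε - 1ℚ) * (1ℚ - i)))
    ∎
  where open ≡-Reasoning

module _ {X α ℓ ε w : ℚ} (1<ℓ : 1ℚ < ℓ) (1<α : 1ℚ < α) (X-bound : α * (1ℚ ÷' ℓ) - 1ℚ ≤ X)
         (1≤ε : 1ℚ ≤ ε) (ε-bound : ε - 1ℚ ≤ ℓ * w) where
  private
    0<ℓ = <-trans 0<1 1<ℓ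
    i = 1ℚ ÷' ℓ
    0<i = 1÷'-pos 0<ℓ
    X-slack = X - (α * i - 1ℚ)
    density-slack = (α - 1ℚ) * (i * (ℓ * w - (ε - 1ℚ)))
    edge-slack = (ε - 1ℚ) * (1ℚ - i)

    lhs≡ : ε * ((α ÷' ℓ) - 1ℚ) ≡ ε * (α * i - 1ℚ)
    lhs≡ = cong (λ q → ε * (q - 1ℚ)) (÷'≡*1÷' 0<ℓ α)

    rhs≡ : X + w * (α - 1ℚ) ≡ ε * (α * i - 1ℚ) + (X-slack + (density-slack + edge-slack))
    rhs≡ = slack-identity X α ℓ i ε w (÷'-*-cancel 0<ℓ 1ℚ)

    0≤X-slack : 0ℚ ≤ X-slack
    0≤X-slack = p≤q⇒0≤q-p X-bound

    0≤density-slack : 0ℚ ≤ density-slack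
    0≤density-slack = *-nonNeg (p≤q⇒0≤q-p (<⇒≤ 1<α)) (*-nonNeg (<⇒≤ 0<i) (p≤q⇒0≤q-p ε-bound))

    0≤edge-slack : 0ℚ ≤ edge-slack
    0≤edge-slack = *-nonNeg (p≤q⇒0≤q-p 1≤ε) (p≤q⇒0≤q-p (<⇒≤ (1÷'<1 1<ℓ)))

    slack-pos : 1ℚ < ε ⊎ ε - 1ℚ < ℓ * w → 0ℚ < density-slack + edge-slack
    slack-pos (inj₁ 1<ε) =
      +-mono-≤-< 0≤density-slack (*-pos (p<q⇒0<q-p 1<ε) (p<q⇒0<q-p (1÷'<1 1<ℓ)))
    slack-pos (inj₂ ε-bound<) =
      +-mono-<-≤ (*-pos (p<q⇒0<q-p 1<α) (*-pos 0<i (p<q⇒0<q-p ε-bound<))) 0≤edge-slack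

  balance-≤ : ε * ((α ÷' ℓ) - 1ℚ) ≤ X + w * (α - 1ℚ)
  balance-≤ = begin
    ε * ((α ÷' ℓ) - 1ℚ)                                            ≡⟨ lhs≡ ⟩
    ε * (α * i - 1ℚ)                                               ≤⟨ p≤p+q slack-nonNeg ⟩
    ε * (α * i - 1ℚ) + (X-slack + (density-slack + edge-slack))  ≡⟨ sym rhs≡ ⟩
    X + w * (α - 1ℚ)                                               ∎
    where
      open ≤-Reasoning
      slack-nonNeg = +-mono-≤ 0≤X-slack (+-mono-≤ 0≤density-slack 0≤edge-slack)

  balance-< : 1ℚ < ε ⊎ ε - 1ℚ < ℓ * w → ε * ((α ÷' ℓ) - 1ℚ) < X + w * (α - 1ℚ)
  balance-< strictly = begin-strict
    ε * ((α ÷' ℓ) - 1ℚ)                                            ≡⟨ lhs≡ ⟩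
    ε * (α * i - 1ℚ)                                               <⟨ p<p+q (+-mono-≤-< 0≤X-slack (slack-pos strictly)) ⟩
    ε * (α * i - 1ℚ) + (X-slack + (density-slack + edge-slack))  ≡⟨ sym rhs≡ ⟩
    X + w * (α - 1ℚ)                                               ∎
    where
      open ≤-Reasoning

lemma3p7 : (𝓗 𝓛 : List Graph) →
    𝓗 ≢ [] → 𝓛 ≢ [] →
    (∀ H → H ∈ 𝓗 → Simple H) → (∀ L → L ∈ 𝓛 → Simple L) →
    StrictlyBalanced 𝓗 𝓛 →
    m2F 𝓛 < m2F 𝓗 → 1ℚ < m2F 𝓛 →
    ∀ L → L ∈ 𝓛 → ∀ K → K ⊆G L → e K ≥ 1 →
      (ℕ→ℚ (e K) * ((m2FL 𝓗 𝓛 ÷' m2 L) - 1ℚ)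
        ≤ Xval 𝓗 (m2FL 𝓗 𝓛) + (ℕ→ℚ (v K) - ℕ→ℚ 2) * (m2FL 𝓗 𝓛 - 1ℚ))
      × (¬ IsK2 K →
         ℕ→ℚ (e K) * ((m2FL 𝓗 𝓛 ÷' m2 L) - 1ℚ)
           < Xval 𝓗 (m2FL 𝓗 𝓛) + (ℕ→ℚ (v K) - ℕ→ℚ 2) * (m2FL 𝓗 𝓛 - 1ℚ))
lemma3p7 𝓗 𝓛 𝓗≢[] _ simple𝓗 simple𝓛 (_ , balanced𝓗) m<m2F𝓗 1<m L L∈𝓛 K K⊆L 1≤eK =
  balance-≤ 1<ℓ 1<α X-bound 1≤ε K-bound ,
  balance-< 1<ℓ 1<α X-bound 1≤ε K-bound ∘ λ ¬K2 → non-K2-slack simpleK 1≤eK ¬K2 (<-trans 0<1 1<ℓ)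
  where
    open BalancedFamily {𝓗} {𝓛} 𝓗≢[] simple𝓗 balanced𝓗 m<m2F𝓗 1<m
    α = m2FL 𝓗 𝓛
    1<α : 1ℚ < α
    1<α = <-trans 1<m m2F<m2FL
    m≤ℓ : m2F 𝓛 ≤ m2 L
    m≤ℓ = minOf-≤ (∈-map⁺ m2 L∈𝓛)
    1<ℓ : 1ℚ < m2 L
    1<ℓ = <-≤-trans 1<m m≤ℓ
    X-bound : α * (1ℚ ÷' m2 L) - 1ℚ ≤ Xval 𝓗 α
    X-bound = ≤-trans (+-monoˡ-≤ (- 1ℚ) (*-monoˡ-≤-nonNeg α {{nonNegative (<⇒≤ (<-trans 0<1 1<α))}}
                                           (1÷'-antimono-≤ (<-trans 0<1 1<m) m≤ℓ)))
                      Xval-lower-bound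
    1≤ε : 1ℚ ≤ ℕ→ℚ (e K)
    1≤ε = ℕ→ℚ-mono-≤ 1≤eK
    simpleK : Simple K
    simpleK = ⊆G-Simple {K} {L} K⊆L (simple𝓛 L L∈𝓛)
    K-bound : ℕ→ℚ (e K) - 1ℚ ≤ m2 L * (ℕ→ℚ (v K) - ℕ→ℚ 2)
    K-bound = subgraph-edge-bound {L} {K} simpleK 1<ℓ K⊆L 1≤eK
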